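{- Consider an iteration of \textsc{Window Sort} with current arrangement $\sigma$ and window size $w$. If an element $x$ satisfies both condition $(\bullet)$ and condition $(\circ)$, then $|computed\_rank(x)-x|\le|E(x,w)|$.
   Context: Elements are $\{1,\dots,n\}$, identified with their true ranks; comparisons are recurrent (each pair's outcome is fixed, possibly erroneous). $\sigma(x)$ is the position of $x$ in the current arrangement $\sigma$. \textsc{Window Sort} iteration with window size $w$ on $\sigma$: for each element $x$, with $l=\sigma(x)$, $wins(x)$ is the number of elements $y$ with $\sigma(y)\in[l-2w,l-1]\cup[l+1,l+2w]$ for which the comparison reports $x>y$, and $computed\_rank(x)=\max\{l-2w,0\}+wins(x)$. $E(x,w)$ is the set of erroneous outcomes among the comparisons between $x$ and every element $y\neq x$ with $y\in[x-4w,x+4w]$. Condition $(\ast)$ for an element $z$ (window size $w$): $|\sigma(z)-z|\le w$. Condition $(\bullet)$ for $x$: $x$ is larger than every element $z$ with $\sigma(z)<\sigma(x)-2w$ and smaller than every element $z$ with $\sigma(z)>\sigma(x)+2w$. Condition $(\circ)$ for $x$: $x$ and every element $z$ with $0<|\sigma(z)-\sigma(x)|\le 2w$ satisfy $(\ast)$. -}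

module Defs where

open import Data.Nat using (ℕ; zero; suc; _+_; _*_; _∸_; _≤_; _<_; ∣_-_∣; _≤ᵇ_; _<ᵇ_; _≡ᵇ_)
open import Data.Bool using (Bool; true; false; not; _∧_; _∨_; if_then_else_)
open import Data.Fin using (Fin; toℕ)
open import Data.Fin.Permutation using (Permutation′; _⟨$⟩ʳ_)
open import Data.List using (List; length; filterᵇ; allFin)
open import Relation.Binary.PropositionalEquality using (_≡_; _≢_)

-- Convention: elements and positions are 0-indexed (Fin n = {0,…,n-1});
-- element x is identified with its true rank toℕ x.
-- σ is an arrangement: a permutation, σ(x) = position of element x.

countFin : ∀ {n} → (Fin n → Bool) → ℕ
countFin {n} P = length (filterᵇ P (allFin n))

pos : ∀ {n} → Permutation′ n → Fin n → ℕ
pos σ x = toℕ (σ ⟨$⟩ʳ x)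

-- Comparison oracle: beats x y = true means the (recurrent) comparison
-- between x and y reports x > y.

inWindow : ∀ {n} → Permutation′ n → ℕ → Fin n → Fin n → Bool
inWindow σ w x y =
  not (pos σ y ≡ᵇ pos σ x) ∧ (pos σ x ≤ᵇ pos σ y + 2 * w) ∧ (pos σ y ≤ᵇ pos σ x + 2 * w)

wins : ∀ {n} → (Fin n → Fin n → Bool) → Permutation′ n → ℕ → Fin n → ℕ
wins beats σ w x = countFin (λ y → inWindow σ w x y ∧ beats x y)

computedRank : ∀ {n} → (Fin n → Fin n → Bool) → Permutation′ n → ℕ → Fin n → ℕ
computedRank beats σ w x = (pos σ x ∸ 2 * w) + wins beats σ w x

trueBeats : ∀ {n} → Fin n → Fin n → Bool
trueBeats x y = toℕ y <ᵇ toℕ x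

_≠ᵇ_ : Bool → Bool → Bool
true ≠ᵇ b = not b
false ≠ᵇ b = b

errCount : ∀ {n} → (Fin n → Fin n → Bool) → ℕ → Fin n → ℕ
errCount beats w x = countFin (λ y →
  not (toℕ y ≡ᵇ toℕ x) ∧ (toℕ x ≤ᵇ toℕ y + 4 * w) ∧ (toℕ y ≤ᵇ toℕ x + 4 * w)
  ∧ (beats x y ≠ᵇ trueBeats x y))

Star : ∀ {n} → Permutation′ n → ℕ → Fin n → Set
Star σ w z = ∣ pos σ z - toℕ z ∣ ≤ w

Bullet : ∀ {n} → Permutation′ n → ℕ → Fin n → Set
Bullet σ w x =
  (∀ z → pos σ z + 2 * w < pos σ x → toℕ z < toℕ x) ×'
  (∀ z → pos σ x + 2 * w < pos σ z → toℕ x < toℕ z)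
  where
  open import Data.Product using () renaming (_×_ to _×'_)

Circ : ∀ {n} → Permutation′ n → ℕ → Fin n → Set
Circ σ w x =
  Star σ w x ×'
  (∀ z → 0 < ∣ pos σ z - pos σ x ∣ → ∣ pos σ z - pos σ x ∣ ≤ 2 * w → Star σ w z)
  where
  open import Data.Product using () renaming (_×_ to _×'_)

Consistent : ∀ {n} → (Fin n → Fin n → Bool) → Set
Consistent beats = ∀ x y → x ≢ y → beats y x ≡ not (beats x y)

module Submission where

-- Compare the run with the given comparator `beats` to the run with
-- the truthful comparator `trueBeats`.  Both computed ranks have the form
-- k + wins with the same offset k = max(σ(x) - 2w, 0), so their distance
-- is the distance between the two win counts.
--   * Exactness (uses (•)): with truthful comparisons the computed rank is
--     exactly x.  Every y < x sits either at a position below k (and all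
--     k such positions hold elements smaller than x) or inside the window.
--   * Stability (uses (∘)): every window element y lies within distance 4w
--     of x (by (∗) for x and y and the triangle inequality), so each window
--     comparison on which the two comparators disagree is counted in E(x,w).
--
-- The argument never
-- uses that comparisons are recurrent (the `Consistent` hypothesis).

open import Defs
open import Data.Nat using (ℕ; _≤_; ∣_-_∣)
open import Data.Bool using (Bool)
open import Data.Fin using (Fin; toℕ)
open import Data.Fin.Permutation using (Permutation′)

open import Data.Nat using (zero; suc; _+_; _*_; _∸_; _<_; _≤ᵇ_; _<ᵇ_; _≡ᵇ_; z≤n; s≤s)
open import Data.Nat.Properties
open import Data.Nat.Tactic.RingSolver using (solve-∀)
open import Data.Bool using (true; false; not; _∧_; T)
open import Data.Bool.Properties using (T-∧)
open import Data.Unit using (tt)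
open import Data.Empty using (⊥-elim)
open import Data.Fin using (zero; suc)
open import Data.Fin.Properties using (toℕ-injective; toℕ<n)
open import Data.Fin.Permutation using (_⟨$⟩ʳ_; _⟨$⟩ˡ_; inverseˡ)
open import Data.List using (length; filterᵇ; tabulate)
open import Data.Product using (_×_; _,_; proj₁; proj₂)
open import Data.Sum using (inj₁; inj₂)
open import Function using (_∘_; id; Equivalence)
open import Relation.Nullary using (¬_)
open import Relation.Binary.PropositionalEquality
  using (_≡_; _≢_; refl; sym; trans; cong; cong₂; subst; module ≡-Reasoning)
open import Algebra.Properties.CommutativeMonoid.Sum +-0-commutativeMonoid
  using (sum; sum-syntax; sum-cong-≗; ∑-distrib-+; sum-replicate-zero; sum-permute)

ind : Bool → ℕ
ind true  = 1
ind false = 0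

count-tabulate : ∀ {A : Set} (P : A → Bool) {m} (f : Fin m → A) →
  length (filterᵇ P (tabulate f)) ≡ ∑[ i < m ] ind (P (f i))
count-tabulate P {zero}  f = refl
count-tabulate P {suc m} f with P (f zero)
... | true  = cong suc (count-tabulate P (f ∘ suc))
... | false = count-tabulate P (f ∘ suc)

countFin-as-sum : ∀ {n} (P : Fin n → Bool) → countFin P ≡ ∑[ y < n ] ind (P y)
countFin-as-sum P = count-tabulate P id

sum-mono : ∀ {n} {f g : Fin n → ℕ} → (∀ i → f i ≤ g i) → sum f ≤ sum g
sum-mono {zero}  f≤g = z≤n
sum-mono {suc n} f≤g = +-mono-≤ (f≤g zero) (sum-mono (f≤g ∘ suc))

countFin-≤-+ : ∀ {n} (P Q R : Fin n → Bool) →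
  (∀ y → ind (P y) ≤ ind (Q y) + ind (R y)) → countFin P ≤ countFin Q + countFin R
countFin-≤-+ P Q R pointwise = begin
  countFin P                                         ≡⟨ countFin-as-sum P ⟩
  ∑[ y < _ ] ind (P y)                               ≤⟨ sum-mono pointwise ⟩
  ∑[ y < _ ] (ind (Q y) + ind (R y))                 ≡⟨ ∑-distrib-+ (ind ∘ Q) (ind ∘ R) ⟩
  ∑[ y < _ ] ind (Q y) + ∑[ y < _ ] ind (R y)        ≡⟨ cong₂ _+_ (countFin-as-sum Q) (countFin-as-sum R) ⟨
  countFin Q + countFin R                            ∎
  where open ≤-Reasoning

count-below : ∀ {n} k → k ≤ n → ∑[ i < n ] ind (toℕ i <ᵇ k) ≡ k
count-below {n}     zero    _         = sum-replicate-zero n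
count-below {suc n} (suc k) (s≤s k≤n) = cong suc (count-below k k≤n)

count-positions-below : ∀ {n} (σ : Permutation′ n) k → k ≤ n →
  ∑[ y < n ] ind (pos σ y <ᵇ k) ≡ k
count-positions-below σ k k≤n =
  trans (sym (sum-permute (λ i → ind (toℕ i <ᵇ k)) σ)) (count-below k k≤n)

pos-injective : ∀ {n} (σ : Permutation′ n) {y x : Fin n} → pos σ y ≡ pos σ x → y ≡ x
pos-injective σ {y} {x} e = begin
  y                        ≡⟨ inverseˡ σ ⟨
  σ ⟨$⟩ˡ (σ ⟨$⟩ʳ y)        ≡⟨ cong (σ ⟨$⟩ˡ_) (toℕ-injective e) ⟩
  σ ⟨$⟩ˡ (σ ⟨$⟩ʳ x)        ≡⟨ inverseˡ σ ⟩
  x                        ∎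
  where open ≡-Reasoning

∣-∣≤⇒≤+ : ∀ {a b d} → ∣ a - b ∣ ≤ d → a ≤ b + d
∣-∣≤⇒≤+ {a} {b} h = ≤-trans (m≤n+∣m-n∣ a b) (+-monoʳ-≤ b h)

∣-∣≤⇒≤+′ : ∀ {a b d} → ∣ a - b ∣ ≤ d → b ≤ a + d
∣-∣≤⇒≤+′ {a} {b} {d} h = ∣-∣≤⇒≤+ (subst (_≤ d) (∣-∣-comm a b) h)

≤+⇒∣-∣≤ : ∀ {a b d} → a ≤ b + d → b ≤ a + d → ∣ a - b ∣ ≤ d
≤+⇒∣-∣≤ {a} {b} {d} a≤b+d b≤a+d with ∣m-n∣≡[m∸n]∨[n∸m] a b
... | inj₁ e = subst (_≤ d) (sym e) (m≤n+o⇒m∸n≤o a b a≤b+d)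
... | inj₂ e = subst (_≤ d) (sym e) (m≤n+o⇒m∸n≤o b a b≤a+d)

below-cut : ∀ {p l c} → p < l ∸ c → p + c < l
below-cut {p} {l} {c} p<l∸c =
  m≤o∸n⇒m+n≤o (suc p) (<⇒≤ (m∸n≢0⇒n<m (λ e → n≮0 (subst (p <_) e p<l∸c)))) p<l∸c

not-below-cut : ∀ {p l c} → ¬ p < l ∸ c → l ≤ p + c
not-below-cut {p} {l} {c} p≮l∸c = begin
  l            ≤⟨ m≤n+m∸n l c ⟩
  c + (l ∸ c)  ≤⟨ +-monoʳ-≤ c (≮⇒≥ p≮l∸c) ⟩
  c + p        ≡⟨ +-comm c p ⟩
  p + c        ∎
  where open ≤-Reasoning

w+[2w+w]≡4w : ∀ w → w + (2 * w + w) ≡ 4 * w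
w+[2w+w]≡4w = solve-∀

T⇒∧-identityˡ : ∀ {a} b → T a → a ∧ b ≡ b
T⇒∧-identityˡ {true} b _ = refl

¬T⇒T-not : ∀ {a} → ¬ T a → T (not a)
¬T⇒T-not {true}  ¬ta = ¬ta tt
¬T⇒T-not {false} _   = tt

T-not⇒¬T : ∀ {a} → T (not a) → ¬ T a
T-not⇒¬T {true} ()

≠ᵇ-comm : ∀ p q → (p ≠ᵇ q) ≡ (q ≠ᵇ p)
≠ᵇ-comm true  true  = refl
≠ᵇ-comm true  false = refl
≠ᵇ-comm false true  = refl
≠ᵇ-comm false false = refl

ind-≤-≠ᵇ : ∀ p q → ind p ≤ ind q + ind (p ≠ᵇ q)
ind-≤-≠ᵇ true  true  = s≤s z≤n
ind-≤-≠ᵇ true  false = s≤s z≤n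
ind-≤-≠ᵇ false _     = z≤n

ind-guarded-≤ : ∀ m p q e → (T m → e ≡ (p ≠ᵇ q)) → ind (m ∧ p) ≤ ind (m ∧ q) + ind e
ind-guarded-≤ false p q e _ = z≤n
ind-guarded-≤ true  p q e h = subst (λ e′ → ind p ≤ ind q + ind e′) (sym (h tt)) (ind-≤-≠ᵇ p q)

ind-split : ∀ b L W → (T L → T b × ¬ T W) → (¬ T L → ¬ T W → ¬ T b) →
  ind b ≡ ind L + ind (W ∧ b)
ind-split true  true  false _ _ = refl
ind-split _     true  true  h _ = ⊥-elim (proj₂ (h tt) tt)
ind-split false true  false h _ = ⊥-elim (proj₁ (h tt))
ind-split _     false true  _ _ = refl
ind-split false false false _ _ = refl
ind-split true  false false _ h = ⊥-elim (h id id tt)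

-- Nearness: p ≠ l and ∣ p - l ∣ ≤ c.  Both the window of x (positions,
-- c = 2w) and the range of E(x,w) (ranks, c = 4w) are of this form.

Near : ℕ → ℕ → ℕ → Set
Near c l p = p ≢ l × ∣ p - l ∣ ≤ c

near-tests : ∀ {c l p} → Near c l p →
  T (not (p ≡ᵇ l)) × T (l ≤ᵇ p + c) × T (p ≤ᵇ l + c)
near-tests {c} {l} {p} (p≢l , ∣p-l∣≤c) =
  ¬T⇒T-not (p≢l ∘ ≡ᵇ⇒≡ p l) , ≤⇒≤ᵇ (∣-∣≤⇒≤+′ {p} ∣p-l∣≤c) , ≤⇒≤ᵇ (∣-∣≤⇒≤+ {p} ∣p-l∣≤c)

near-guard : ∀ {c l p} → Near c l p → ∀ d →
  (not (p ≡ᵇ l) ∧ (l ≤ᵇ p + c) ∧ (p ≤ᵇ l + c) ∧ d) ≡ d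
near-guard near d with near-tests near
... | t₁ , t₂ , t₃ =
  trans (T⇒∧-identityˡ _ t₁) (trans (T⇒∧-identityˡ _ t₂) (T⇒∧-identityˡ d t₃))

near-complete : ∀ {c l p} → Near c l p → T (not (p ≡ᵇ l) ∧ (l ≤ᵇ p + c) ∧ (p ≤ᵇ l + c))
near-complete near with near-tests near
... | t₁ , t₂ , t₃ = Equivalence.from T-∧ (t₁ , Equivalence.from T-∧ (t₂ , t₃))

near-sound : ∀ {c l p} → T (not (p ≡ᵇ l) ∧ (l ≤ᵇ p + c) ∧ (p ≤ᵇ l + c)) → Near c l p
near-sound {c} {l} {p} t with Equivalence.to T-∧ t
... | t₁ , t₂₃ with Equivalence.to T-∧ t₂₃
... | t₂ , t₃ =
  T-not⇒¬T t₁ ∘ ≡⇒≡ᵇ p l , ≤+⇒∣-∣≤ (≤ᵇ⇒≤ p (l + c) t₃) (≤ᵇ⇒≤ l (p + c) t₂)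

inWindow-near : ∀ {n} (σ : Permutation′ n) w (x y : Fin n) →
  T (inWindow σ w x y) → Near (2 * w) (pos σ x) (pos σ y)
inWindow-near σ w x y = near-sound {2 * w} {pos σ x} {pos σ y}

computedRank-exact : ∀ {n} (σ : Permutation′ n) w (x : Fin n) →
  Bullet σ w x → computedRank trueBeats σ w x ≡ toℕ x
computedRank-exact {n} σ w x (smaller-left , larger-right) = sym (begin
  toℕ x                                                         ≡⟨ count-below (toℕ x) (<⇒≤ (toℕ<n x)) ⟨
  ∑[ y < n ] ind (trueBeats x y)                                ≡⟨ sum-cong-≗ rank-split ⟩
  ∑[ y < n ] (ind (pos σ y <ᵇ k) + ind (inW y ∧ trueBeats x y)) ≡⟨ ∑-distrib-+ (λ y → ind (pos σ y <ᵇ k)) (λ y → ind (inW y ∧ trueBeats x y)) ⟩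
  ∑[ y < n ] ind (pos σ y <ᵇ k) + ∑[ y < n ] ind (inW y ∧ trueBeats x y)
    ≡⟨ cong₂ _+_ (count-positions-below σ k k≤n) (sym (countFin-as-sum (λ y → inW y ∧ trueBeats x y))) ⟩
  k + wins trueBeats σ w x                                      ∎)
  where
  open ≡-Reasoning
  l = pos σ x
  k = l ∸ 2 * w
  inW = inWindow σ w x

  k≤n : k ≤ n
  k≤n = ≤-trans (m∸n≤m l (2 * w)) (<⇒≤ (toℕ<n (σ ⟨$⟩ʳ x)))

  smaller-in-window : ∀ y → toℕ y < toℕ x → ¬ pos σ y < k → Near (2 * w) l (pos σ y)
  smaller-in-window y y<x ¬below =
    (λ e → <-irrefl (cong toℕ (pos-injective σ e)) y<x) ,
    ≤+⇒∣-∣≤ (≮⇒≥ (λ far → <-asym y<x (larger-right y far))) (not-below-cut ¬below)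

  rank-split : ∀ y → ind (trueBeats x y) ≡ ind (pos σ y <ᵇ k) + ind (inW y ∧ trueBeats x y)
  rank-split y = ind-split _ _ _ below-k-smaller other-smaller-in-window
    where
    below-k-smaller : T (pos σ y <ᵇ k) → T (trueBeats x y) × ¬ T (inW y)
    below-k-smaller t =
      <⇒<ᵇ (smaller-left y far) , λ tw → <⇒≱ far (∣-∣≤⇒≤+′ {pos σ y} (proj₂ (inWindow-near σ w x y tw)))
      where far = below-cut (<ᵇ⇒< (pos σ y) k t)

    other-smaller-in-window : ¬ T (pos σ y <ᵇ k) → ¬ T (inW y) → ¬ T (trueBeats x y)
    other-smaller-in-window ¬below ¬inW t =
      ¬inW (near-complete (smaller-in-window y (<ᵇ⇒< (toℕ y) (toℕ x) t) (¬below ∘ <⇒<ᵇ)))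

-- A window element is within rank distance 4w of x, by (∗) for x and y.
window-near-in-rank : ∀ {n} (σ : Permutation′ n) w (x y : Fin n) → Circ σ w x →
  Near (2 * w) (pos σ x) (pos σ y) → Near (4 * w) (toℕ x) (toℕ y)
window-near-in-rank σ w x y (star-x , star-nbr) (py≢l , ∣py-l∣≤2w) =
  (λ e → py≢l (cong (pos σ) (toℕ-injective e))) , (begin
    ∣ ty - tx ∣                   ≤⟨ ∣-∣-triangle ty py tx ⟩
    ∣ ty - py ∣ + ∣ py - tx ∣     ≤⟨ +-mono-≤ star-y (≤-trans (∣-∣-triangle py l tx) (+-mono-≤ ∣py-l∣≤2w star-x)) ⟩
    w + (2 * w + w)               ≡⟨ w+[2w+w]≡4w w ⟩
    4 * w                         ∎)
  where
  open ≤-Reasoning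
  tx = toℕ x
  ty = toℕ y
  l = pos σ x
  py = pos σ y
  star-y : ∣ ty - py ∣ ≤ w
  star-y = subst (_≤ w) (∣-∣-comm py ty)
    (star-nbr y (n≢0⇒n>0 (py≢l ∘ ∣m-n∣≡0⇒m≡n)) ∣py-l∣≤2w)

wins-stable : ∀ {n} (beats : Fin n → Fin n → Bool) (σ : Permutation′ n) w (x : Fin n) →
  Circ σ w x → ∣ wins beats σ w x - wins trueBeats σ w x ∣ ≤ errCount beats w x
wins-stable beats σ w x circ = ≤+⇒∣-∣≤
  (countFin-≤-+ _ _ _ (λ y → ind-guarded-≤ (inW y) _ _ _ (error-recorded y)))
  (countFin-≤-+ _ _ _ (λ y → ind-guarded-≤ (inW y) _ _ _
    (λ t → trans (error-recorded y t) (≠ᵇ-comm (beats x y) (trueBeats x y)))))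
  where
  inW = inWindow σ w x

  error-recorded : ∀ y → T (inW y) →
    (not (toℕ y ≡ᵇ toℕ x) ∧ (toℕ x ≤ᵇ toℕ y + 4 * w) ∧ (toℕ y ≤ᵇ toℕ x + 4 * w)
      ∧ (beats x y ≠ᵇ trueBeats x y)) ≡ (beats x y ≠ᵇ trueBeats x y)
  error-recorded y t = near-guard (window-near-in-rank σ w x y circ (inWindow-near σ w x y t)) _

mainTheorem9 : (n : ℕ) (beats : Fin n → Fin n → Bool) → Consistent beats →
    (σ : Permutation′ n) (w : ℕ) (x : Fin n) →
    Bullet σ w x → Circ σ w x →
    ∣ computedRank beats σ w x - toℕ x ∣ ≤ errCount beats w x
mainTheorem9 n beats _ σ w x bullet circ = begin
  ∣ k + A - toℕ x ∣   ≡⟨ cong (λ t → ∣ k + A - t ∣) (computedRank-exact σ w x bullet) ⟨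
  ∣ k + A - k + B ∣   ≡⟨ ∣m+n-m+o∣≡∣n-o∣ k A B ⟩
  ∣ A - B ∣           ≤⟨ wins-stable beats σ w x circ ⟩
  errCount beats w x  ∎
  where
  open ≤-Reasoning
  k = pos σ x ∸ 2 * w
  A = wins beats σ w x
  B = wins trueBeats σ w x
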